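{- Let $G$ be a finite group and let $\pi=\{C_1,\dots,C_\ell\}$ be a collection of $\ell$ distinct subsets of $G$, each of size $k$ and containing the identity $e$, such that any two distinct cells intersect exactly in $\{e\}$ and $\pi$ satisfies the $T$-axiom. Then the spectrum (multiset of adjacency eigenvalues) of the Cayley incidence graph $\mathrm{BCay}(G,\pi)$ is determined by the spectrum of the underlying Cayley graph $\mathrm{Cay}(G,S(\pi))$, the order $|G|$, and the integers $k$ and $\ell$.
   Context: For $C\subseteq G$ and $g\in G$, $gC=\{gs:s\in C\}$. A collection $\pi$ of subsets of $G$, each containing $e$, satisfies the $T$-axiom if for every $C\in\pi$ and every $s\in C$ we have $s^{ -1}C\in\pi$. The Cayley incidence graph $\mathrm{BCay}(G,\pi)$ is the bipartite graph with parts $\gamma=G$ and $\beta=\{gC:g\in G,C\in\pi\}$ (a set of subsets of $G$), with an edge between $g$ and $gC$ for every $g\in G$, $C\in\pi$; equivalently $g\in\gamma$ is adjacent to $D\in\beta$ iff $g\in D$. $S(\pi)=\bigcup_{i=1}^{\ell}C_i\setminus\{e\}$, and $\mathrm{Cay}(G,S)$ is the graph on $G$ with $g\sim h$ iff $h^{ -1}g\in S$. -}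

module Defs where

open import Data.Nat using (ℕ; zero; suc; _+_)
open import Data.Bool using (Bool; true; false; if_then_else_; _∧_; not)
import Data.Bool.Properties as BoolP
open import Data.Fin using (Fin; zero; suc; punchIn; splitAt; _≟_)
open import Data.Fin.Subset using (Subset; _∈_; _∩_; ⁅_⁆; ∣_∣; ⋃)
open import Data.Vec using (Vec; tabulate; lookup)
open import Data.Vec.Properties using (≡-dec)
open import Data.List using (List; []; _∷_; length; map; concatMap; allFin; deduplicate; sum)
import Data.List as L
open import Data.Integer using (ℤ; +_; _-_; _*_; -_) renaming (_^_ to _^ℤ_; _+_ to _+ℤ_)
import Data.Integer as ℤ
open import Data.Sum using (inj₁; inj₂)
open import Data.Product using (Σ; _×_; ∃)
open import Relation.Binary.PropositionalEquality using (_≡_; _≢_)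
open import Relation.Nullary using (yes; no; ¬_)
open import Relation.Nullary.Decidable using (⌊_⌋)
open import Algebra.Structures using (IsGroup)
open import Function.Definitions using (Injective)

-- Finite groups: a group structure (with propositional equality) on Fin n.
-- Every finite group of order n is isomorphic to one of these.

record FinGroup (n : ℕ) : Set where
  field
    _·_     : Fin n → Fin n → Fin n
    e       : Fin n
    inv     : Fin n → Fin n
    isGroup : IsGroup _≡_ _·_ e inv

Matrix : ℕ → Set
Matrix n = Fin n → Fin n → ℤ

det : (n : ℕ) → Matrix n → ℤ
det zero    A = + 1
det (suc n) A =
  L.foldr _+ℤ_ (+ 0)
    (map (λ j → ((- + 1) ^ℤ Data.Fin.toℕ j) * (A zero j * det n (λ r c → A (suc r) (punchIn j c))))
         (allFin (suc n)))

charPoly : (n : ℕ) → Matrix n → ℤ → ℤ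
charPoly n A t = det n (λ i j → (if ⌊ i ≟ j ⌋ then t else + 0) - A i j)

-- Two (adjacency) matrices are cospectral (same multiset of eigenvalues):
-- same size and the same characteristic polynomial.
-- (Integer polynomials agreeing at all integer points are equal.)
Cospectral : (n : ℕ) → Matrix n → (m : ℕ) → Matrix m → Set
Cospectral n A m B = (n ≡ m) × (∀ t → charPoly n A t ≡ charPoly m B t)

b2z : Bool → ℤ
b2z true  = + 1
b2z false = + 0

module _ {n : ℕ} (G : FinGroup n) where
  open FinGroup G

  -- gC = { g s : s ∈ C };  h ∈ gC  iff  g⁻¹ h ∈ C
  translate : Fin n → Subset n → Subset n
  translate g C = tabulate (λ h → lookup C (inv g · h))

  record Hyp (k ℓ : ℕ) (π : Fin ℓ → Subset n) : Set where
    field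
      distinct    : Injective _≡_ _≡_ π
      size        : ∀ i → ∣ π i ∣ ≡ k
      contains-e  : ∀ i → e ∈ π i
      intersect   : ∀ i j → i ≢ j → π i ∩ π j ≡ ⁅ e ⁆
      T-axiom     : ∀ i s → s ∈ π i → ∃ λ j → translate (inv s) (π i) ≡ π j

  Sπ : {ℓ : ℕ} → (Fin ℓ → Subset n) → Subset n
  Sπ π = tabulate (λ g → lookup (⋃ (L.map π (allFin _))) g ∧ not ⌊ g ≟ e ⌋)

  CayAdj : Subset n → Matrix n
  CayAdj S g h = b2z (lookup S (inv h · g))

  blocks : {ℓ : ℕ} → (Fin ℓ → Subset n) → List (Subset n)
  blocks π = deduplicate (≡-dec BoolP._≟_)
    (concatMap (λ g → L.map (λ i → translate g (π i)) (allFin _)) (allFin n))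

  nβ : {ℓ : ℕ} → (Fin ℓ → Subset n) → ℕ
  nβ π = length (blocks π)

  -- adjacency matrix of BCay(G,π) on vertex set γ ⊎ β (γ = G first)
  BCayAdj : {ℓ : ℕ} → (π : Fin ℓ → Subset n) → Matrix (n + nβ π)
  BCayAdj π x y with splitAt n x | splitAt n y
  ... | inj₁ g | inj₂ D = b2z (lookup (L.lookup (blocks π) D) g)
  ... | inj₂ D | inj₁ g = b2z (lookup (L.lookup (blocks π) D) g)
  ... | _      | _      = + 0

-- Let N be the incidence matrix of the points γ = G against the blocks β.  Distinct cells meet only in e and,
-- by the T-axiom, the blocks through a point h are exactly h C₁, …, h C_ℓ; hence N Nᵀ = ℓ I + A for the
-- adjacency matrix A of Cay(G, S(π)), and double counting incidences gives |β| k = |G| ℓ, so |β| is determined.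
-- BCay(G, π) has adjacency matrix [[0, N], [Nᵀ, 0]], and the Schur complement identity
--   t^|G| det (t I − BCay) = t^|β| det ((t² − ℓ) I − A)
-- determines its characteristic polynomial at every t ≠ 0, hence everywhere, as it is a polynomial.
module Submission where

open import Algebra.Bundles using (Group)
open import Algebra.Structures using (IsGroup)
import Algebra.Properties.Group as GroupProperties
open import Data.Bool using (Bool; true; false; if_then_else_; _∧_; _∨_; not)
open import Data.Bool.Properties using (∧-identityʳ; ∧-zeroʳ)
import Data.Bool.Properties as Boolₚ
open import Data.Empty using (⊥-elim)
open import Data.Fin using (Fin; zero; suc; punchIn; punchOut; toℕ; _↑ˡ_; _↑ʳ_; splitAt; join; _≟_)
open import Data.Fin.Properties
  using ( punchInᵢ≢i; punchOut-punchIn; punchOut-cong; suc-injective; toℕ-↑ˡ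
        ; splitAt-↑ˡ; splitAt-↑ʳ; join-splitAt)
open import Data.Fin.Permutation using (Permutation; permutation; lift₀-transpose)
open import Data.Fin.Permutation.Components using (transpose)
open import Data.Fin.Subset using (Subset; _∈_; _⊆_; _∩_; ⁅_⁆; ∣_∣; ⋃)
open import Data.Fin.Subset.Properties using (x∈⁅y⁆⇒x≡y; p⊆q⇒∣p∣≤∣q∣; ∣⁅x⁆∣≡1)
open import Data.Integer using (ℤ; +_; -[1+_]; _+_; _-_; _*_; -_; 0ℤ; 1ℤ; -1ℤ; _^_; ≢-nonZero)
open import Data.Integer.Properties hiding (_≟_)
open import Data.Integer.Tactic.RingSolver using (solve-∀)
open import Data.List as List using (List; allFin; concatMap)
open import Data.List.Properties using (map-tabulate)
open import Data.List.Membership.Propositional as ListMembership using ()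
open import Data.List.Membership.Propositional.Properties
  using (∈-deduplicate⁺; ∈-deduplicate⁻; ∈-concatMap⁺; ∈-concatMap⁻; ∈-map⁺; ∈-map⁻; ∈-allFin
        ; ∈-lookup)
import Data.List.Relation.Unary.All as All
open import Data.List.Relation.Unary.AllPairs using (_∷_)
import Data.List.Relation.Unary.Any as Any
open import Data.List.Relation.Unary.Any.Properties using (lookup-index)
open import Data.List.Relation.Unary.Unique.Propositional using (Unique)
open import Data.List.Relation.Unary.Unique.DecPropositional.Properties using (deduplicate-!)
open import Data.Nat as ℕ using (ℕ; zero; suc)
import Data.Nat.Properties as ℕₚ
open import Data.Product using (∃; ∃₂; _,_; proj₁; proj₂)
open import Data.Sum using (inj₁; inj₂; [_,_])
import Data.Sum.Properties as Sum
open import Data.Vec using ([]; _∷_; lookup; tabulate)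
open import Data.Vec.Properties
  using ( ≡-dec; lookup∘tabulate; tabulate∘lookup; tabulate-cong; lookup-zipWith; lookup-replicate
        ; []=⇒lookup; lookup⇒[]=)
open import Function using (_∘_; Injective)
open import Relation.Binary.PropositionalEquality
open import Relation.Nullary using (yes; no)
open import Relation.Nullary.Decidable using (⌊_⌋; dec-true; dec-false; ⌊⌋-map′)
open import Algebra.Properties.CommutativeMonoid.Sum +-0-commutativeMonoid
  using (sum; sum-syntax; sum-cong-≗; sum-replicate-zero; sum-remove; ∑-comm; sum-permute)
open import Algebra.Properties.Semiring.Sum +-*-semiring using (*-distribˡ-sum; *-distribʳ-sum)

open import Defs

-- Finite sums of integers

sum-zero : ∀ {n} {f : Fin n → ℤ} → (∀ i → f i ≡ 0ℤ) → sum f ≡ 0ℤ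
sum-zero {n} f≡0 = trans (sum-cong-≗ f≡0) (sum-replicate-zero n)

sum-single : ∀ {n} (f : Fin n → ℤ) j → (∀ i → i ≢ j → f i ≡ 0ℤ) → sum f ≡ f j
sum-single {suc n} f j f≡0 = begin
  sum f                       ≡⟨ sum-remove f ⟩
  f j + sum (f ∘ punchIn j)   ≡⟨ cong (λ s → f j + s) (sum-zero (λ i → f≡0 _ (punchInᵢ≢i j i))) ⟩
  f j + 0ℤ                    ≡⟨ +-identityʳ (f j) ⟩
  f j                         ∎
  where open ≡-Reasoning

sum-↑ : ∀ n {m} (f : Fin (n ℕ.+ m) → ℤ) → sum f ≡ sum (f ∘ (_↑ˡ m)) + sum (f ∘ (n ↑ʳ_))
sum-↑ zero    f = sym (+-identityˡ (sum f))
sum-↑ (suc n) f = trans (cong (λ s → f zero + s) (sum-↑ n (f ∘ suc))) (sym (+-assoc (f zero) _ _))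

sum-neg : ∀ {n} (f : Fin n → ℤ) → sum (λ i → - f i) ≡ - sum f
sum-neg f = begin
  sum (λ i → - f i)      ≡⟨ sum-cong-≗ (λ i → sym (-1*i≡-i (f i))) ⟩
  sum (λ i → -1ℤ * f i)  ≡⟨ *-distribˡ-sum -1ℤ f ⟨
  -1ℤ * sum f            ≡⟨ -1*i≡-i (sum f) ⟩
  - sum f                ∎
  where open ≡-Reasoning

sum-const : ∀ n c → ∑[ i < n ] (+ c) ≡ + (n ℕ.* c)
sum-const zero    c = refl
sum-const (suc n) c = cong (λ s → + c + s) (sum-const n c)

foldr-allFin≡sum : ∀ n (f : Fin n → ℤ) → List.foldr _+_ 0ℤ (List.map f (allFin n)) ≡ sum f
foldr-allFin≡sum n f = trans (cong (List.foldr _+_ 0ℤ) (map-tabulate (λ i → i) f)) (foldr-tabulate n f)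
  where
  foldr-tabulate : ∀ n (f : Fin n → ℤ) → List.foldr _+_ 0ℤ (List.tabulate f) ≡ sum f
  foldr-tabulate zero    f = refl
  foldr-tabulate (suc n) f = cong (λ s → f zero + s) (foldr-tabulate n (f ∘ suc))

-- Determinants: Laplace expansion and row swaps

sgn : ∀ {n} → Fin n → ℤ
sgn j = (- + 1) ^ toℕ j

minor : ∀ {n} → Matrix (suc n) → Fin (suc n) → Matrix n
minor A j r c = A (suc r) (punchIn j c)

det-expand : ∀ n (A : Matrix (suc n)) → det (suc n) A ≡ ∑[ j < suc n ] (sgn j * (A zero j * det n (minor A j)))
det-expand n A = foldr-allFin≡sum (suc n) (λ j → sgn j * (A zero j * det n (minor A j)))

det-cong : ∀ n {A B : Matrix n} → (∀ r c → A r c ≡ B r c) → det n A ≡ det n B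
det-cong zero    A≡B = refl
det-cong (suc n) {A} {B} A≡B = begin
  det (suc n) A                                            ≡⟨ det-expand n A ⟩
  ∑[ j < suc n ] (sgn j * (A zero j * det n (minor A j)))  ≡⟨ sum-cong-≗ expansion-cong ⟩
  ∑[ j < suc n ] (sgn j * (B zero j * det n (minor B j)))  ≡⟨ det-expand n B ⟨
  det (suc n) B                                            ∎
  where
  open ≡-Reasoning
  expansion-cong : ∀ j → sgn j * (A zero j * det n (minor A j)) ≡ sgn j * (B zero j * det n (minor B j))
  expansion-cong j = cong₂ (λ a d → sgn j * (a * d)) (A≡B zero j) (det-cong n (λ r c → A≡B (suc r) (punchIn j c)))

transpose-matchˡ : ∀ {n} (i j : Fin n) → transpose i j i ≡ j
transpose-matchˡ i j rewrite dec-true (i ≟ i) refl = refl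

transpose-matchʳ : ∀ {n} (i j : Fin n) → transpose i j j ≡ i
transpose-matchʳ i j with j ≟ i
... | yes refl = refl
... | no _ rewrite dec-true (j ≟ j) refl = refl

transpose-fix : ∀ {n} {i j k : Fin n} → k ≢ i → k ≢ j → transpose i j k ≡ k
transpose-fix {i = i} {j} {k} k≢i k≢j rewrite dec-false (k ≟ i) k≢i | dec-false (k ≟ j) k≢j = refl

transpose-comm : ∀ {n} (i j k : Fin n) → transpose i j k ≡ transpose j i k
transpose-comm i j k with i ≟ k | j ≟ k
... | yes refl | yes refl = refl
... | yes refl | no _     = trans (transpose-matchˡ k j) (sym (transpose-matchʳ j k))
... | no _     | yes refl = trans (transpose-matchʳ i k) (sym (transpose-matchˡ k i))
... | no i≢k   | no j≢k   =
  trans (transpose-fix (i≢k ∘ sym) (j≢k ∘ sym)) (sym (transpose-fix (j≢k ∘ sym) (i≢k ∘ sym)))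

transpose-conj : ∀ {n} (j : Fin n) k → let τ₁ⱼ = transpose (suc zero) (suc (suc j)) in
                 transpose zero (suc (suc j)) k ≡ τ₁ⱼ (transpose zero (suc zero) (τ₁ⱼ k))
transpose-conj j zero          = refl
transpose-conj j (suc zero)    = sym (transpose-matchʳ (suc zero) (suc (suc j)))
transpose-conj j (suc (suc k)) with j ≟ k
... | yes refl = trans (transpose-matchʳ zero (suc (suc j))) (sym (cong τ (transpose-matchʳ (suc zero) (suc (suc j)))))
  where τ = transpose (suc zero) (suc (suc j)) ∘ transpose zero (suc zero)
... | no j≢k   = trans (transpose-fix {i = zero} (λ ()) k≢j) (sym (trans (cong τ fixed) fixed))
  where
  τ = transpose (suc zero) (suc (suc j)) ∘ transpose zero (suc zero)
  k≢j : suc (suc k) ≢ suc (suc j)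
  k≢j refl = j≢k refl
  fixed : transpose (suc zero) (suc (suc j)) (suc (suc k)) ≡ suc (suc k)
  fixed = transpose-fix {i = suc zero} (λ ()) k≢j

sgn-punchOut : ∀ {n} (c₁ c₂ : Fin (suc (suc n))) (p : c₁ ≢ c₂) (q : c₂ ≢ c₁) →
               sgn c₁ * sgn (punchOut p) ≡ - (sgn c₂ * sgn (punchOut q))
sgn-punchOut zero     zero     p q = ⊥-elim (p refl)
sgn-punchOut zero     (suc c₂) p q = flip (sgn c₂)
  where flip : ∀ s → 1ℤ * s ≡ - ((-1ℤ * s) * 1ℤ)
        flip = solve-∀
sgn-punchOut (suc c₁) zero     p q = flip (sgn c₁)
  where flip : ∀ s → (-1ℤ * s) * 1ℤ ≡ - (1ℤ * s)
        flip = solve-∀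
sgn-punchOut {zero}  (suc zero) (suc zero) p q = ⊥-elim (p refl)
sgn-punchOut {suc n} (suc c₁)   (suc c₂)   p q = begin
  (-1ℤ * sgn c₁) * (-1ℤ * sgn (punchOut p′))        ≡⟨ cancel-signs (sgn c₁) _ ⟩
  sgn c₁ * sgn (punchOut p′)                        ≡⟨ sgn-punchOut c₁ c₂ p′ q′ ⟩
  - (sgn c₂ * sgn (punchOut q′))                    ≡⟨ cong -_ (cancel-signs (sgn c₂) _) ⟨
  - ((-1ℤ * sgn c₂) * (-1ℤ * sgn (punchOut q′)))    ∎
  where
  open ≡-Reasoning
  p′ = p ∘ cong suc
  q′ = q ∘ cong suc
  cancel-signs : ∀ a b → (-1ℤ * a) * (-1ℤ * b) ≡ a * b
  cancel-signs = solve-∀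

punchIn-punchOut-comm : ∀ {n} (c₁ c₂ : Fin (suc (suc n))) (p : c₁ ≢ c₂) (q : c₂ ≢ c₁) (c : Fin n) →
                        punchIn c₁ (punchIn (punchOut p) c) ≡ punchIn c₂ (punchIn (punchOut q) c)
punchIn-punchOut-comm zero     zero     p q c = ⊥-elim (p refl)
punchIn-punchOut-comm zero     (suc c₂) p q c = refl
punchIn-punchOut-comm (suc c₁) zero     p q c = refl
punchIn-punchOut-comm {zero}  (suc zero) (suc zero) p q c       = ⊥-elim (p refl)
punchIn-punchOut-comm {suc n} (suc c₁)   (suc c₂)   p q zero    = refl
punchIn-punchOut-comm {suc n} (suc c₁)   (suc c₂)   p q (suc c) =
  cong suc (punchIn-punchOut-comm c₁ c₂ (p ∘ cong suc) (q ∘ cong suc) c)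

-- Expansion along two rows u, v with complementary minors D c₁ k (columns c₁ and punchIn c₁ k removed).
module Laplace₂ {n} (D : Fin (suc (suc n)) → Fin (suc n) → ℤ) where

  laplace₂ : (u v : Fin (suc (suc n)) → ℤ) → ℤ
  laplace₂ u v = ∑[ c < suc (suc n) ] (sgn c * (u c * ∑[ k < suc n ] (sgn k * (v (punchIn c k) * D c k))))

  columnPair : (u v : Fin (suc (suc n)) → ℤ) → Fin (suc (suc n)) → Fin (suc (suc n)) → ℤ
  columnPair u v c₁ c₂ with c₁ ≟ c₂
  ... | yes _ = 0ℤ
  ... | no p  = sgn c₁ * (u c₁ * (sgn (punchOut p) * (v c₂ * D c₁ (punchOut p))))

  laplace₂-columnPairs : ∀ u v → laplace₂ u v ≡ ∑[ c₁ < _ ] ∑[ c₂ < _ ] columnPair u v c₁ c₂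
  laplace₂-columnPairs u v = sum-cong-≗ row
    where
    row : ∀ c → sgn c * (u c * ∑[ k < suc n ] (sgn k * (v (punchIn c k) * D c k))) ≡ ∑[ c₂ < _ ] columnPair u v c c₂
    row c = begin
      sgn c * (u c * ∑[ k < _ ] X k)              ≡⟨ cong (sgn c *_) (*-distribˡ-sum (u c) X) ⟩
      sgn c * ∑[ k < _ ] (u c * X k)              ≡⟨ *-distribˡ-sum (sgn c) (λ k → u c * X k) ⟩
      ∑[ k < _ ] (sgn c * (u c * X k))            ≡⟨ sum-cong-≗ (λ k → sym (columnPair-punchIn k)) ⟩
      ∑[ k < _ ] columnPair u v c (punchIn c k)   ≡⟨ +-identityˡ _ ⟨
      0ℤ + ∑[ k < _ ] columnPair u v c (punchIn c k)
        ≡⟨ cong (λ x → x + ∑[ k < _ ] columnPair u v c (punchIn c k)) columnPair-diag ⟨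
      columnPair u v c c + ∑[ k < _ ] columnPair u v c (punchIn c k)
        ≡⟨ sum-remove (columnPair u v c) ⟨
      ∑[ c₂ < _ ] columnPair u v c c₂             ∎
      where
      open ≡-Reasoning
      X : Fin (suc n) → ℤ
      X k = sgn k * (v (punchIn c k) * D c k)
      columnPair-diag : columnPair u v c c ≡ 0ℤ
      columnPair-diag with c ≟ c
      ... | yes _  = refl
      ... | no c≢c = ⊥-elim (c≢c refl)
      columnPair-punchIn : ∀ k → columnPair u v c (punchIn c k) ≡ sgn c * (u c * X k)
      columnPair-punchIn k with c ≟ punchIn c k
      ... | yes c≡ = ⊥-elim (punchInᵢ≢i c k (sym c≡))
      ... | no c≢  = cong (λ k′ → sgn c * (u c * (sgn k′ * (v (punchIn c k) * D c k′))))
                          (trans (punchOut-cong c refl) (punchOut-punchIn c))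

  module _ (D-sym : ∀ {c₁ c₂} (p : c₁ ≢ c₂) (q : c₂ ≢ c₁) → D c₁ (punchOut p) ≡ D c₂ (punchOut q)) where

    columnPair-antisym : ∀ u v c₁ c₂ → columnPair v u c₁ c₂ ≡ - columnPair u v c₂ c₁
    columnPair-antisym u v c₁ c₂ with c₁ ≟ c₂ | c₂ ≟ c₁
    ... | yes _    | yes _    = refl
    ... | yes refl | no c≢c   = ⊥-elim (c≢c refl)
    ... | no c≢c   | yes refl = ⊥-elim (c≢c refl)
    ... | no p     | no q     = begin
      sgn c₁ * (v c₁ * (sgn (punchOut p) * (u c₂ * D c₁ (punchOut p))))
        ≡⟨ cong (λ d → sgn c₁ * (v c₁ * (sgn (punchOut p) * (u c₂ * d)))) (D-sym p q) ⟩
      sgn c₁ * (v c₁ * (sgn (punchOut p) * (u c₂ * d)))     ≡⟨ regroup (sgn c₁) _ (v c₁) (u c₂) d ⟩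
      (sgn c₁ * sgn (punchOut p)) * (v c₁ * (u c₂ * d))
        ≡⟨ cong (_* (v c₁ * (u c₂ * d))) (sgn-punchOut c₁ c₂ p q) ⟩
      - (sgn c₂ * sgn (punchOut q)) * (v c₁ * (u c₂ * d))    ≡⟨ regroup′ (sgn c₂) _ (v c₁) (u c₂) d ⟩
      - (sgn c₂ * (u c₂ * (sgn (punchOut q) * (v c₁ * d))))  ∎
      where
      open ≡-Reasoning
      d = D c₂ (punchOut q)
      regroup : ∀ s t x y d → s * (x * (t * (y * d))) ≡ (s * t) * (x * (y * d))
      regroup = solve-∀
      regroup′ : ∀ s t x y d → - (s * t) * (x * (y * d)) ≡ - (s * (y * (t * (x * d))))
      regroup′ = solve-∀

    laplace₂-antisym : ∀ u v → laplace₂ v u ≡ - laplace₂ u v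
    laplace₂-antisym u v = begin
      laplace₂ v u                                       ≡⟨ laplace₂-columnPairs v u ⟩
      ∑[ c₁ < _ ] ∑[ c₂ < _ ] columnPair v u c₁ c₂       ≡⟨ ∑-comm (columnPair v u) ⟩
      ∑[ c₂ < _ ] ∑[ c₁ < _ ] columnPair v u c₁ c₂
        ≡⟨ sum-cong-≗ (λ c₂ → sum-cong-≗ (λ c₁ → columnPair-antisym u v c₁ c₂)) ⟩
      ∑[ c₂ < _ ] ∑[ c₁ < _ ] (- columnPair u v c₂ c₁)
        ≡⟨ sum-cong-≗ (λ c₂ → sum-neg (columnPair u v c₂)) ⟩
      ∑[ c₂ < _ ] (- ∑[ c₁ < _ ] columnPair u v c₂ c₁)
        ≡⟨ sum-neg (λ c₂ → ∑[ c₁ < _ ] columnPair u v c₂ c₁) ⟩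
      - ∑[ c₂ < _ ] ∑[ c₁ < _ ] columnPair u v c₂ c₁     ≡⟨ cong -_ (laplace₂-columnPairs u v) ⟨
      - laplace₂ u v                                     ∎
      where open ≡-Reasoning

open Laplace₂ using (laplace₂; laplace₂-antisym)

det-laplace₂ : ∀ n (A : Matrix (suc (suc n))) →
               det (suc (suc n)) A ≡ laplace₂ (λ c → det n ∘ minor (minor A c)) (A zero) (A (suc zero))
det-laplace₂ n A = trans (det-expand (suc n) A)
  (sum-cong-≗ (λ c → cong (λ d → sgn c * (A zero c * d)) (det-expand n (minor A c))))

RowSwapNegates : ℕ → Set
RowSwapNegates n = ∀ (A : Matrix n) {i j} → i ≢ j → det n (A ∘ transpose i j) ≡ - det n A

det-swap-suc : ∀ {n} → RowSwapNegates n → ∀ (A : Matrix (suc n)) {i j} → i ≢ j →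
               det (suc n) (A ∘ transpose (suc i) (suc j)) ≡ - det (suc n) A
det-swap-suc {n} swap A {i} {j} i≢j = begin
  det (suc n) (A ∘ τ)                                            ≡⟨ det-expand n (A ∘ τ) ⟩
  ∑[ c < suc n ] (sgn c * (A zero c * det n (minor (A ∘ τ) c)))  ≡⟨ sum-cong-≗ negate-minor ⟩
  ∑[ c < suc n ] (- term c)                                      ≡⟨ sum-neg term ⟩
  - ∑[ c < suc n ] term c                                        ≡⟨ cong -_ (det-expand n A) ⟨
  - det (suc n) A                                                ∎
  where
  open ≡-Reasoning
  τ = transpose (suc i) (suc j)
  term : Fin (suc n) → ℤ
  term c = sgn c * (A zero c * det n (minor A c))
  pull-neg : ∀ s a d → s * (a * - d) ≡ - (s * (a * d))
  pull-neg = solve-∀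
  negate-minor : ∀ c → sgn c * (A zero c * det n (minor (A ∘ τ) c)) ≡ - term c
  negate-minor c = begin
    sgn c * (A zero c * det n (minor (A ∘ τ) c))            ≡⟨ cong (λ d → sgn c * (A zero c * d)) (det-cong n lift) ⟩
    sgn c * (A zero c * det n (minor A c ∘ transpose i j))
      ≡⟨ cong (λ d → sgn c * (A zero c * d)) (swap (minor A c) i≢j) ⟩
    sgn c * (A zero c * - det n (minor A c))                ≡⟨ pull-neg (sgn c) (A zero c) _ ⟩
    - term c                                                ∎
    where
    lift : ∀ r c′ → minor (A ∘ τ) c r c′ ≡ minor A c (transpose i j r) c′
    lift r c′ = cong (λ x → A x (punchIn c c′)) (lift₀-transpose i j (suc r))

det-swap-01 : ∀ n (A : Matrix (suc (suc n))) → det (suc (suc n)) (A ∘ transpose zero (suc zero)) ≡ - det (suc (suc n)) A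
det-swap-01 n A = begin
  det (suc (suc n)) (A ∘ transpose zero (suc zero))  ≡⟨ det-laplace₂ n (A ∘ transpose zero (suc zero)) ⟩
  laplace₂ D (A (suc zero)) (A zero)                 ≡⟨ laplace₂-antisym D D-sym (A zero) (A (suc zero)) ⟩
  - laplace₂ D (A zero) (A (suc zero))               ≡⟨ cong -_ (det-laplace₂ n A) ⟨
  - det (suc (suc n)) A                              ∎
  where
  open ≡-Reasoning
  D : Fin (suc (suc n)) → Fin (suc n) → ℤ
  D c = det n ∘ minor (minor A c)
  D-sym : ∀ {c₁ c₂} (p : c₁ ≢ c₂) (q : c₂ ≢ c₁) → D c₁ (punchOut p) ≡ D c₂ (punchOut q)
  D-sym {c₁} {c₂} p q = det-cong n (λ r c → cong (A (suc (suc r))) (punchIn-punchOut-comm c₁ c₂ p q c))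

det-swap-zero : ∀ n → RowSwapNegates (suc n) → ∀ (A : Matrix (suc (suc n))) j →
                det (suc (suc n)) (A ∘ transpose zero (suc j)) ≡ - det (suc (suc n)) A
det-swap-zero n swap A zero    = det-swap-01 n A
det-swap-zero n swap A (suc j) = begin
  det (suc (suc n)) (A ∘ transpose zero (suc (suc j)))
    ≡⟨ det-cong (suc (suc n)) (λ r c → cong (λ x → A x c) (transpose-conj j r)) ⟩
  det (suc (suc n)) (((A ∘ τ) ∘ transpose zero (suc zero)) ∘ τ)
    ≡⟨ det-swap-suc swap ((A ∘ τ) ∘ transpose zero (suc zero)) {zero} {suc j} (λ ()) ⟩
  - det (suc (suc n)) ((A ∘ τ) ∘ transpose zero (suc zero))   ≡⟨ cong -_ (det-swap-01 n (A ∘ τ)) ⟩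
  - - det (suc (suc n)) (A ∘ τ)                               ≡⟨ neg-involutive _ ⟩
  det (suc (suc n)) (A ∘ τ)                                   ≡⟨ det-swap-suc swap A {zero} {suc j} (λ ()) ⟩
  - det (suc (suc n)) A                                       ∎
  where
  open ≡-Reasoning
  τ = transpose (suc zero) (suc (suc j))

-- A swap of two later rows passes to the minors of the first-row expansion, a swap of the first two rows is
-- laplace₂-antisym, and a swap (0 j) is the conjugate (1 j) (0 1) (1 j).
det-swap : ∀ n → RowSwapNegates n
det-swap (suc n)       A {zero}  {zero}  i≢j = ⊥-elim (i≢j refl)
det-swap (suc n)       A {suc i} {suc j} i≢j = det-swap-suc (det-swap n) A (i≢j ∘ cong suc)
det-swap (suc (suc n)) A {zero}  {suc j} _   = det-swap-zero n (det-swap (suc n)) A j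
det-swap (suc (suc n)) A {suc i} {zero}  _   =
  trans (det-cong (suc (suc n)) (λ r c → cong (λ x → A x c) (transpose-comm (suc i) zero r)))
        (det-swap-zero n (det-swap (suc n)) A i)

i≡-i⇒i≡0 : ∀ {i} → i ≡ - i → i ≡ 0ℤ
i≡-i⇒i≡0 {+ zero}    _ = refl
i≡-i⇒i≡0 {+ suc _}   ()
i≡-i⇒i≡0 { -[1+ _ ]} ()

det-repeatedRow : ∀ n (A : Matrix n) {i j} → i ≢ j → (∀ c → A i c ≡ A j c) → det n A ≡ 0ℤ
det-repeatedRow n A {i} {j} i≢j Aᵢ≡Aⱼ = i≡-i⇒i≡0 (begin
  det n A                     ≡⟨ det-cong n swap-invisible ⟨
  det n (A ∘ transpose i j)   ≡⟨ det-swap n A i≢j ⟩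
  - det n A                   ∎)
  where
  open ≡-Reasoning
  swap-invisible : ∀ r c → A (transpose i j r) c ≡ A r c
  swap-invisible r c with i ≟ r | j ≟ r
  ... | yes refl | _        = trans (cong (λ x → A x c) (transpose-matchˡ r j)) (sym (Aᵢ≡Aⱼ c))
  ... | no _     | yes refl = trans (cong (λ x → A x c) (transpose-matchʳ i r)) (Aᵢ≡Aⱼ c)
  ... | no i≢r   | no j≢r   = cong (λ x → A x c) (transpose-fix (i≢r ∘ sym) (j≢r ∘ sym))

withFirstRow : ∀ {n} → (Fin (suc n) → ℤ) → Matrix (suc n) → Matrix (suc n)
withFirstRow u A zero    = u
withFirstRow u A (suc r) = A (suc r)

det-withFirstRow-linear : ∀ n {p} (A : Matrix (suc n)) (λs : Fin p → ℤ) (v : Fin p → Fin (suc n) → ℤ) →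
  det (suc n) (withFirstRow (λ c → ∑[ q < p ] (λs q * v q c)) A) ≡
  ∑[ q < p ] (λs q * det (suc n) (withFirstRow (v q) A))
det-withFirstRow-linear n {p} A λs v = begin
  det (suc n) (withFirstRow (λ c → ∑[ q < p ] (λs q * v q c)) A)
    ≡⟨ det-expand n (withFirstRow (λ c → ∑[ q < p ] (λs q * v q c)) A) ⟩
  ∑[ c < suc n ] (sgn c * (∑[ q < p ] (λs q * v q c) * d c))   ≡⟨ sum-cong-≗ distribute ⟩
  ∑[ c < suc n ] ∑[ q < p ] (λs q * (sgn c * (v q c * d c)))
    ≡⟨ ∑-comm (λ c q → λs q * (sgn c * (v q c * d c))) ⟩
  ∑[ q < p ] ∑[ c < suc n ] (λs q * (sgn c * (v q c * d c)))
    ≡⟨ sum-cong-≗ (λ q → *-distribˡ-sum (λs q) (λ c → sgn c * (v q c * d c))) ⟨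
  ∑[ q < p ] (λs q * ∑[ c < suc n ] (sgn c * (v q c * d c)))
    ≡⟨ sum-cong-≗ (λ q → cong (λs q *_) (det-expand n (withFirstRow (v q) A))) ⟨
  ∑[ q < p ] (λs q * det (suc n) (withFirstRow (v q) A))       ∎
  where
  open ≡-Reasoning
  d : Fin (suc n) → ℤ
  d c = det n (minor A c)
  regroup : ∀ s l x y → s * (l * x * y) ≡ l * (s * (x * y))
  regroup = solve-∀
  distribute : ∀ c → sgn c * (∑[ q < p ] (λs q * v q c) * d c) ≡ ∑[ q < p ] (λs q * (sgn c * (v q c * d c)))
  distribute c = begin
    sgn c * (∑[ q < p ] (λs q * v q c) * d c)     ≡⟨ cong (sgn c *_) (*-distribʳ-sum (d c) (λ q → λs q * v q c)) ⟩
    sgn c * ∑[ q < p ] (λs q * v q c * d c)       ≡⟨ *-distribˡ-sum (sgn c) (λ q → λs q * v q c * d c) ⟩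
    ∑[ q < p ] (sgn c * (λs q * v q c * d c))     ≡⟨ sum-cong-≗ (λ q → regroup (sgn c) (λs q) (v q c) (d c)) ⟩
    ∑[ q < p ] (λs q * (sgn c * (v q c * d c)))   ∎

det-addRowsToFirst : ∀ n {p} (A : Matrix (suc n)) t (λs : Fin p → ℤ) (σ : Fin p → Fin n) →
  det (suc n) (withFirstRow (λ c → t * A zero c + ∑[ q < p ] (λs q * A (suc (σ q)) c)) A) ≡ t * det (suc n) A
det-addRowsToFirst n {p} A t λs σ = begin
  det (suc n) (withFirstRow (λ c → ∑[ q < suc p ] (λs′ q * v q c)) A)  ≡⟨ det-withFirstRow-linear n A λs′ v ⟩
  t * det (suc n) A + ∑[ q < p ] (λs q * det (suc n) (withFirstRow (A (suc (σ q))) A))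
    ≡⟨ cong (λ s → t * det (suc n) A + s) (sum-zero (λ q → trans (cong (λs q *_) (repeated q)) (*-zeroʳ (λs q)))) ⟩
  t * det (suc n) A + 0ℤ                                                ≡⟨ +-identityʳ _ ⟩
  t * det (suc n) A                                                     ∎
  where
  open ≡-Reasoning
  λs′ : Fin (suc p) → ℤ
  λs′ zero    = t
  λs′ (suc q) = λs q
  v : Fin (suc p) → Fin (suc n) → ℤ
  v zero    = A zero
  v (suc q) = A (suc (σ q))
  repeated : ∀ q → det (suc n) (withFirstRow (A (suc (σ q))) A) ≡ 0ℤ
  repeated q = det-repeatedRow (suc n) (withFirstRow (A (suc (σ q))) A) {zero} {suc (σ q)} (λ ()) (λ c → refl)

-- Scalar and block matrices; the Schur complement

scalar : ∀ {n} → ℤ → Matrix n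
scalar t i j = if ⌊ i ≟ j ⌋ then t else 0ℤ

scalar-diag : ∀ {n} t (i : Fin n) → scalar t i i ≡ t
scalar-diag t i with i ≟ i
... | yes _   = refl
... | no i≢i = ⊥-elim (i≢i refl)

scalar-offDiag : ∀ {n} t {i j : Fin n} → i ≢ j → scalar t i j ≡ 0ℤ
scalar-offDiag t {i} {j} i≢j with i ≟ j
... | yes i≡j = ⊥-elim (i≢j i≡j)
... | no _    = refl

scalar-suc : ∀ {n} t (i j : Fin n) → scalar t (suc i) (suc j) ≡ scalar t i j
scalar-suc t i j with i ≟ j
... | yes _ = refl
... | no _  = refl

det-scalar : ∀ n t → det n (scalar t) ≡ t ^ n
det-scalar zero    t = refl
det-scalar (suc n) t = begin
  det (suc n) (scalar t)                    ≡⟨ det-expand n (scalar t) ⟩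
  ∑[ j < suc n ] term j                     ≡⟨ sum-single term zero off-diagonal ⟩
  1ℤ * (t * det n (minor (scalar t) zero))  ≡⟨ cong (λ d → 1ℤ * (t * d)) (det-cong n (scalar-suc t)) ⟩
  1ℤ * (t * det n (scalar t))               ≡⟨ cong (λ d → 1ℤ * (t * d)) (det-scalar n t) ⟩
  1ℤ * (t * t ^ n)                          ≡⟨ *-identityˡ _ ⟩
  t ^ suc n                                 ∎
  where
  open ≡-Reasoning
  term : Fin (suc n) → ℤ
  term j = sgn j * (scalar t zero j * det n (minor (scalar t) j))
  off-diagonal : ∀ j → j ≢ zero → term j ≡ 0ℤ
  off-diagonal j j≢0 = begin
    sgn j * (scalar t zero j * det n (minor (scalar t) j))
      ≡⟨ cong (λ x → sgn j * (x * det n (minor (scalar t) j))) (scalar-offDiag t (j≢0 ∘ sym)) ⟩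
    sgn j * (0ℤ * det n (minor (scalar t) j))             ≡⟨ cong (sgn j *_) (*-zeroˡ (det n (minor (scalar t) j))) ⟩
    sgn j * 0ℤ                                            ≡⟨ *-zeroʳ (sgn j) ⟩
    0ℤ                                                    ∎

blockMatrix : ∀ {n m} → Matrix n → (Fin n → Fin m → ℤ) → (Fin m → Fin n → ℤ) → Matrix m →
              Matrix (n ℕ.+ m)
blockMatrix {n} P B C Q x y with splitAt n x | splitAt n y
... | inj₁ i | inj₁ j = P i j
... | inj₁ i | inj₂ b = B i b
... | inj₂ a | inj₁ j = C a j
... | inj₂ a | inj₂ b = Q a b

module _ {n m} (P : Matrix n) (B : Fin n → Fin m → ℤ) (C : Fin m → Fin n → ℤ) (Q : Matrix m) where

  blockMatrix-↑ˡ↑ˡ : ∀ i j → blockMatrix P B C Q (i ↑ˡ m) (j ↑ˡ m) ≡ P i j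
  blockMatrix-↑ˡ↑ˡ i j rewrite splitAt-↑ˡ n i m | splitAt-↑ˡ n j m = refl

  blockMatrix-↑ˡ↑ʳ : ∀ i b → blockMatrix P B C Q (i ↑ˡ m) (n ↑ʳ b) ≡ B i b
  blockMatrix-↑ˡ↑ʳ i b rewrite splitAt-↑ˡ n i m | splitAt-↑ʳ n m b = refl

  blockMatrix-↑ʳ↑ˡ : ∀ a j → blockMatrix P B C Q (n ↑ʳ a) (j ↑ˡ m) ≡ C a j
  blockMatrix-↑ʳ↑ˡ a j rewrite splitAt-↑ʳ n m a | splitAt-↑ˡ n j m = refl

  blockMatrix-↑ʳ↑ʳ : ∀ a b → blockMatrix P B C Q (n ↑ʳ a) (n ↑ʳ b) ≡ Q a b
  blockMatrix-↑ʳ↑ʳ a b rewrite splitAt-↑ʳ n m a | splitAt-↑ʳ n m b = refl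

↑-cases : ∀ {n m} (R : Fin (n ℕ.+ m) → Set) → (∀ i → R (i ↑ˡ m)) → (∀ a → R (n ↑ʳ a)) → ∀ x → R x
↑-cases {n} {m} R left right x = subst R (join-splitAt n m x) ([_,_] {C = R ∘ join n m} left right (splitAt n x))

punchIn-↑ˡ : ∀ {n} m (j : Fin (suc n)) (c : Fin n) → punchIn (j ↑ˡ m) (c ↑ˡ m) ≡ punchIn j c ↑ˡ m
punchIn-↑ˡ m zero    c       = refl
punchIn-↑ˡ m (suc j) zero    = refl
punchIn-↑ˡ m (suc j) (suc c) = cong suc (punchIn-↑ˡ m j c)

punchIn-↑ʳ : ∀ {n m} (j : Fin (suc n)) (a : Fin m) → punchIn (j ↑ˡ m) (n ↑ʳ a) ≡ suc n ↑ʳ a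
punchIn-↑ʳ             zero    a = refl
punchIn-↑ʳ {suc n} {m} (suc j) a = cong suc (punchIn-↑ʳ j a)

minor-blockMatrix : ∀ {n m} (P : Matrix (suc n)) B C Q j r c →
  minor (blockMatrix {suc n} {m} P B C Q) (j ↑ˡ m) r c ≡
  blockMatrix (minor P j) (B ∘ suc) (λ a → C a ∘ punchIn j) Q r c
minor-blockMatrix {n} {m} P B C Q j =
  ↑-cases _ (λ i → ↑-cases _ (left-left i) (left-right i)) (λ a → ↑-cases _ (right-left a) (right-right a))
  where
  M = blockMatrix {suc n} {m} P B C Q
  P′ = minor P j
  B′ = B ∘ suc
  C′ = λ a → C a ∘ punchIn j
  M′ = blockMatrix P′ B′ C′ Q
  left-left : ∀ i c → M (suc i ↑ˡ m) (punchIn (j ↑ˡ m) (c ↑ˡ m)) ≡ M′ (i ↑ˡ m) (c ↑ˡ m)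
  left-left i c = trans (cong (M (suc i ↑ˡ m)) (punchIn-↑ˡ m j c))
    (trans (blockMatrix-↑ˡ↑ˡ P B C Q (suc i) (punchIn j c)) (sym (blockMatrix-↑ˡ↑ˡ P′ B′ C′ Q i c)))
  left-right : ∀ i b → M (suc i ↑ˡ m) (punchIn (j ↑ˡ m) (n ↑ʳ b)) ≡ M′ (i ↑ˡ m) (n ↑ʳ b)
  left-right i b = trans (cong (M (suc i ↑ˡ m)) (punchIn-↑ʳ j b))
    (trans (blockMatrix-↑ˡ↑ʳ P B C Q (suc i) b) (sym (blockMatrix-↑ˡ↑ʳ P′ B′ C′ Q i b)))
  right-left : ∀ a c → M (suc n ↑ʳ a) (punchIn (j ↑ˡ m) (c ↑ˡ m)) ≡ M′ (n ↑ʳ a) (c ↑ˡ m)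
  right-left a c = trans (cong (M (suc n ↑ʳ a)) (punchIn-↑ˡ m j c))
    (trans (blockMatrix-↑ʳ↑ˡ P B C Q a (punchIn j c)) (sym (blockMatrix-↑ʳ↑ˡ P′ B′ C′ Q a c)))
  right-right : ∀ a b → M (suc n ↑ʳ a) (punchIn (j ↑ˡ m) (n ↑ʳ b)) ≡ M′ (n ↑ʳ a) (n ↑ʳ b)
  right-right a b = trans (cong (M (suc n ↑ʳ a)) (punchIn-↑ʳ j b))
    (trans (blockMatrix-↑ʳ↑ʳ P B C Q a b) (sym (blockMatrix-↑ʳ↑ʳ P′ B′ C′ Q a b)))

sgn-↑ˡ : ∀ {n} m (j : Fin n) → sgn (j ↑ˡ m) ≡ sgn j
sgn-↑ˡ m j = cong ((- + 1) ^_) (toℕ-↑ˡ j m)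

det-withFirstRow-↑ˡ : ∀ n m (M : Matrix (suc n ℕ.+ m)) u → (∀ b → u (suc n ↑ʳ b) ≡ 0ℤ) →
  det (suc n ℕ.+ m) (withFirstRow u M) ≡ ∑[ j < suc n ] (sgn j * (u (j ↑ˡ m) * det (n ℕ.+ m) (minor M (j ↑ˡ m))))
det-withFirstRow-↑ˡ n m M u u≡0 = begin
  det (suc K) (withFirstRow u M)                                  ≡⟨ det-expand K (withFirstRow u M) ⟩
  ∑[ c < suc K ] term c                                           ≡⟨ sum-↑ (suc n) term ⟩
  ∑[ j < suc n ] term (j ↑ˡ m) + ∑[ b < m ] term (suc n ↑ʳ b)
    ≡⟨ cong (λ s → ∑[ j < suc n ] term (j ↑ˡ m) + s) (sum-zero right) ⟩
  ∑[ j < suc n ] term (j ↑ˡ m) + 0ℤ                               ≡⟨ +-identityʳ _ ⟩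
  ∑[ j < suc n ] term (j ↑ˡ m)
    ≡⟨ sum-cong-≗ (λ j → cong (_* (u (j ↑ˡ m) * det K (minor M (j ↑ˡ m)))) (sgn-↑ˡ m j)) ⟩
  ∑[ j < suc n ] (sgn j * (u (j ↑ˡ m) * det K (minor M (j ↑ˡ m)))) ∎
  where
  open ≡-Reasoning
  K = n ℕ.+ m
  term : Fin (suc K) → ℤ
  term c = sgn c * (u c * det K (minor M c))
  right : ∀ b → term (suc n ↑ʳ b) ≡ 0ℤ
  right b = trans (cong (λ x → sgn (suc n ↑ʳ b) * (x * d)) (u≡0 b)) (solve-zero (sgn (suc n ↑ʳ b)) d)
    where
    d = det K (minor M (suc n ↑ʳ b))
    solve-zero : ∀ s d → s * (0ℤ * d) ≡ 0ℤ
    solve-zero = solve-∀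

schurComplement : ∀ {n m} → ℤ → Matrix n → (Fin n → Fin m → ℤ) → (Fin m → Fin n → ℤ) → Matrix n
schurComplement {m = m} t P B C i j = t * P i j - ∑[ a < m ] (B i a * C a j)

module _ {n m} (t : ℤ) (P : Matrix (suc n)) (B : Fin (suc n) → Fin m → ℤ) (C : Fin m → Fin (suc n) → ℤ) where

  private
    M = blockMatrix P B C (scalar t)

  clearedRow : Fin (suc n ℕ.+ m) → ℤ
  clearedRow c = t * M zero c + ∑[ a < m ] (- B zero a * M (suc (n ↑ʳ a)) c)

  clearedRow-↑ˡ : ∀ j → clearedRow (j ↑ˡ m) ≡ schurComplement t P B C zero j
  clearedRow-↑ˡ j = cong₂ _+_ (cong (t *_) (blockMatrix-↑ˡ↑ˡ P B C (scalar t) zero j)) (begin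
    ∑[ a < m ] (- B zero a * M (suc n ↑ʳ a) (j ↑ˡ m))
      ≡⟨ sum-cong-≗ (λ a → cong (- B zero a *_) (blockMatrix-↑ʳ↑ˡ P B C (scalar t) a j)) ⟩
    ∑[ a < m ] (- B zero a * C a j)     ≡⟨ sum-cong-≗ (λ a → neg-distribˡ-* (B zero a) (C a j)) ⟨
    ∑[ a < m ] (- (B zero a * C a j))   ≡⟨ sum-neg (λ a → B zero a * C a j) ⟩
    - ∑[ a < m ] (B zero a * C a j)     ∎)
    where open ≡-Reasoning

  clearedRow-↑ʳ : ∀ b → clearedRow (suc n ↑ʳ b) ≡ 0ℤ
  clearedRow-↑ʳ b = begin
    t * M zero (suc n ↑ʳ b) + ∑[ a < m ] (- B zero a * M (suc n ↑ʳ a) (suc n ↑ʳ b))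
      ≡⟨ cong₂ (λ x y → t * x + y) (blockMatrix-↑ˡ↑ʳ P B C (scalar t) zero b)
               (sum-cong-≗ (λ a → cong (- B zero a *_) (blockMatrix-↑ʳ↑ʳ P B C (scalar t) a b))) ⟩
    t * B zero b + ∑[ a < m ] (- B zero a * scalar t a b)
      ≡⟨ cong (λ s → t * B zero b + s) (sum-single _ b off-diagonal) ⟩
    t * B zero b + - B zero b * scalar t b b   ≡⟨ cong (λ x → t * B zero b + - B zero b * x) (scalar-diag t b) ⟩
    t * B zero b + - B zero b * t              ≡⟨ cancel t (B zero b) ⟩
    0ℤ                                         ∎
    where
    open ≡-Reasoning
    off-diagonal : ∀ a → a ≢ b → - B zero a * scalar t a b ≡ 0ℤ
    off-diagonal a a≢b = trans (cong (- B zero a *_) (scalar-offDiag t a≢b)) (*-zeroʳ (- B zero a))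
    cancel : ∀ t x → t * x + - x * t ≡ 0ℤ
    cancel = solve-∀

-- Clear the right half of the first row by a row operation, expand along it, and recurse on the minors,
-- which are block matrices of the same shape.
det-schur : ∀ n m t (P : Matrix n) B C →
            t ^ n * det (n ℕ.+ m) (blockMatrix P B C (scalar t)) ≡ t ^ m * det n (schurComplement t P B C)
det-schur zero    m t P B C = trans (*-identityˡ _) (trans (det-scalar m t) (sym (*-identityʳ (t ^ m))))
det-schur (suc n) m t P B C = begin
  t ^ suc n * det (suc K) M                                 ≡⟨ shift-power t (t ^ n) (det (suc K) M) ⟩
  t ^ n * (t * det (suc K) M)
    ≡⟨ cong (t ^ n *_) (det-addRowsToFirst K M t (λ a → - B zero a) (n ↑ʳ_)) ⟨
  t ^ n * det (suc K) (withFirstRow (clearedRow t P B C) M)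
    ≡⟨ cong (t ^ n *_) (det-withFirstRow-↑ˡ n m M (clearedRow t P B C) (clearedRow-↑ʳ t P B C)) ⟩
  t ^ n * ∑[ j < suc n ] expansion j                        ≡⟨ *-distribˡ-sum (t ^ n) expansion ⟩
  ∑[ j < suc n ] (t ^ n * expansion j)                      ≡⟨ sum-cong-≗ minor-schur ⟩
  ∑[ j < suc n ] (t ^ m * (sgn j * (S zero j * det n (minor S j))))
    ≡⟨ *-distribˡ-sum (t ^ m) (λ j → sgn j * (S zero j * det n (minor S j))) ⟨
  t ^ m * ∑[ j < suc n ] (sgn j * (S zero j * det n (minor S j))) ≡⟨ cong (t ^ m *_) (det-expand n S) ⟨
  t ^ m * det (suc n) S                                     ∎
  where
  open ≡-Reasoning
  K = n ℕ.+ m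
  M = blockMatrix P B C (scalar t)
  S = schurComplement t P B C
  expansion : Fin (suc n) → ℤ
  expansion j = sgn j * (clearedRow t P B C (j ↑ˡ m) * det K (minor M (j ↑ˡ m)))
  shift-power : ∀ t s d → t * s * d ≡ s * (t * d)
  shift-power = solve-∀
  regroup : ∀ p s x d → p * (s * (x * d)) ≡ s * (x * (p * d))
  regroup = solve-∀
  minor-schur : ∀ j → t ^ n * expansion j ≡ t ^ m * (sgn j * (S zero j * det n (minor S j)))
  minor-schur j = begin
    t ^ n * expansion j
      ≡⟨ cong₂ (λ x d → t ^ n * (sgn j * (x * d)))
               (clearedRow-↑ˡ t P B C j) (det-cong K (minor-blockMatrix P B C (scalar t) j)) ⟩
    t ^ n * (sgn j * (S zero j * det K (blockMatrix (minor P j) (B ∘ suc) (λ a → C a ∘ punchIn j) (scalar t))))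
      ≡⟨ regroup (t ^ n) (sgn j) (S zero j) _ ⟩
    sgn j * (S zero j * (t ^ n * det K (blockMatrix (minor P j) (B ∘ suc) (λ a → C a ∘ punchIn j) (scalar t))))
      ≡⟨ cong (λ d → sgn j * (S zero j * d)) (det-schur n m t (minor P j) (B ∘ suc) (λ a → C a ∘ punchIn j)) ⟩
    sgn j * (S zero j * (t ^ m * det n (minor S j)))
      ≡⟨ regroup (t ^ m) (sgn j) (S zero j) (det n (minor S j)) ⟨
    t ^ m * (sgn j * (S zero j * det n (minor S j)))
      ∎

-- Polynomial functions ℤ → ℤ

Δ : (ℤ → ℤ) → ℤ → ℤ
Δ f t = f (t + 1ℤ) - f t

-- f agrees on ℤ with a polynomial of degree ≤ d, characterised by Δᵈ f being constant.
Polynomial : ℕ → (ℤ → ℤ) → Set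
Polynomial zero    f = ∀ t → f t ≡ f 0ℤ
Polynomial (suc d) f = Polynomial d (Δ f)

Polynomial-cong : ∀ d {f g} → (∀ t → f t ≡ g t) → Polynomial d f → Polynomial d g
Polynomial-cong zero    f≡g p t = trans (sym (f≡g t)) (trans (p t) (f≡g 0ℤ))
Polynomial-cong (suc d) f≡g p   = Polynomial-cong d (λ t → cong₂ _-_ (f≡g (t + 1ℤ)) (f≡g t)) p

Polynomial-const : ∀ d c → Polynomial d (λ _ → c)
Polynomial-const zero    c t = refl
Polynomial-const (suc d) c   = Polynomial-cong d (λ _ → sym (+-inverseʳ c)) (Polynomial-const d 0ℤ)

Polynomial-id : Polynomial 1 (λ t → t)
Polynomial-id t = trans (Δ-id t) (sym (Δ-id 0ℤ))
  where Δ-id : ∀ t → t + 1ℤ - t ≡ 1ℤ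
        Δ-id = solve-∀

Polynomial-+ : ∀ d f g → Polynomial d f → Polynomial d g → Polynomial d (λ t → f t + g t)
Polynomial-+ zero    f g p q t = cong₂ _+_ (p t) (q t)
Polynomial-+ (suc d) f g p q   =
  Polynomial-cong d (λ t → Δ-+ (f (t + 1ℤ)) (g (t + 1ℤ)) (f t) (g t)) (Polynomial-+ d (Δ f) (Δ g) p q)
  where Δ-+ : ∀ a b c d → (a - c) + (b - d) ≡ (a + b) - (c + d)
        Δ-+ = solve-∀

Polynomial-scale : ∀ d c f → Polynomial d f → Polynomial d (λ t → c * f t)
Polynomial-scale zero    c f p t = cong (c *_) (p t)
Polynomial-scale (suc d) c f p   =
  Polynomial-cong d (λ t → Δ-scale c (f (t + 1ℤ)) (f t)) (Polynomial-scale d c (Δ f) p)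
  where Δ-scale : ∀ c a b → c * (a - b) ≡ c * a - c * b
        Δ-scale = solve-∀

Polynomial-shift : ∀ d f → Polynomial d f → Polynomial d (λ t → f (t + 1ℤ))
Polynomial-shift zero    f p t = trans (p (t + 1ℤ)) (sym (p 1ℤ))
Polynomial-shift (suc d) f p   = Polynomial-shift d (Δ f) p

Polynomial-* : ∀ a b f g → Polynomial a f → Polynomial b g → Polynomial (a ℕ.+ b) (λ t → f t * g t)
Polynomial-* zero    b       f g p q =
  Polynomial-cong b (λ t → cong (_* g t) (sym (p t))) (Polynomial-scale b (f 0ℤ) g q)
Polynomial-* (suc a) zero    f g p q = subst (λ d → Polynomial d (λ t → f t * g t)) (sym (ℕₚ.+-identityʳ (suc a)))
  (Polynomial-cong (suc a) (λ t → trans (*-comm (g 0ℤ) (f t)) (cong (f t *_) (sym (q t))))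
                   (Polynomial-scale (suc a) (g 0ℤ) f p))
Polynomial-* (suc a) (suc b) f g p q =
  Polynomial-cong (a ℕ.+ suc b) (λ t → product-rule (f (t + 1ℤ)) (f t) (g (t + 1ℤ)) (g t))
    (Polynomial-+ (a ℕ.+ suc b) (λ t → f (t + 1ℤ) * Δ g t) (λ t → Δ f t * g t)
      (subst (λ d → Polynomial d (λ t → f (t + 1ℤ) * Δ g t)) (sym (ℕₚ.+-suc a b))
        (Polynomial-* (suc a) b (λ t → f (t + 1ℤ)) (Δ g) (Polynomial-shift (suc a) f p) q))
      (Polynomial-* a (suc b) (Δ f) g p q))
  where
  product-rule : ∀ f₁ f₀ g₁ g₀ → f₁ * (g₁ - g₀) + (f₁ - f₀) * g₀ ≡ f₁ * g₁ - f₀ * g₀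
  product-rule = solve-∀

Polynomial-sum : ∀ n d (F : Fin n → ℤ → ℤ) → (∀ i → Polynomial d (F i)) →
                 Polynomial d (λ t → ∑[ i < n ] F i t)
Polynomial-sum zero    d F p = Polynomial-const d 0ℤ
Polynomial-sum (suc n) d F p = Polynomial-+ d _ _ (p zero) (Polynomial-sum n d (F ∘ suc) (p ∘ suc))

det-polynomial : ∀ n (A : ℤ → Matrix n) → (∀ i j → Polynomial 1 (λ t → A t i j)) →
                 Polynomial n (λ t → det n (A t))
det-polynomial zero    A p = Polynomial-const 0 1ℤ
det-polynomial (suc n) A p =
  Polynomial-cong (suc n) (λ t → sym (det-expand n (A t)))
    (Polynomial-sum (suc n) (suc n) (λ j t → sgn j * (A t zero j * det n (minor (A t) j))) (λ j →
      Polynomial-scale (suc n) (sgn j) _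
        (Polynomial-* 1 n (λ t → A t zero j) (λ t → det n (minor (A t) j)) (p zero j)
          (det-polynomial n (λ t → minor (A t) j) (λ r c → p (suc r) (punchIn j c))))))

charPoly-polynomial : ∀ n (A : Matrix n) → Polynomial n (charPoly n A)
charPoly-polynomial n A =
  det-polynomial n (λ t i j → (if ⌊ i ≟ j ⌋ then t else 0ℤ) - A i j) (λ i j → entry ⌊ i ≟ j ⌋ (A i j))
  where
  entry : ∀ b c → Polynomial 1 (λ t → (if b then t else 0ℤ) - c)
  entry true  c = Polynomial-+ 1 (λ t → t) (λ _ → - c) Polynomial-id (Polynomial-const 1 (- c))
  entry false c = Polynomial-const 1 (0ℤ - c)

Polynomial-vanishing : ∀ d {h} → Polynomial d h → (∀ k → h (+ suc k) ≡ 0ℤ) → h 0ℤ ≡ 0ℤ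
Polynomial-vanishing zero        p h≡0 = trans (sym (p 1ℤ)) (h≡0 0)
Polynomial-vanishing (suc d) {h} p h≡0 = begin
  h 0ℤ            ≡⟨ back (h 1ℤ) (h 0ℤ) ⟩
  h 1ℤ - Δ h 0ℤ   ≡⟨ cong₂ _-_ (h≡0 0) (Polynomial-vanishing d p Δh≡0) ⟩
  0ℤ              ∎
  where
  open ≡-Reasoning
  back : ∀ a b → b ≡ a - (a - b)
  back = solve-∀
  Δh≡0 : ∀ k → Δ h (+ suc k) ≡ 0ℤ
  Δh≡0 k = cong₂ _-_ (h≡0 (k ℕ.+ 1)) (h≡0 k)

Polynomial-unique : ∀ d {f g} → Polynomial d f → Polynomial d g → (∀ t → t ≢ 0ℤ → f t ≡ g t) →
                    ∀ t → f t ≡ g t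
Polynomial-unique d {f} {g} p q f≡g (+ zero) = begin
  f 0ℤ                         ≡⟨ split (f 0ℤ) (g 0ℤ) ⟩
  (f 0ℤ + -1ℤ * g 0ℤ) + g 0ℤ   ≡⟨ cong (_+ g 0ℤ) (Polynomial-vanishing d difference-polynomial difference) ⟩
  0ℤ + g 0ℤ                    ≡⟨ +-identityˡ (g 0ℤ) ⟩
  g 0ℤ                         ∎
  where
  open ≡-Reasoning
  split : ∀ a b → a ≡ (a + -1ℤ * b) + b
  split = solve-∀
  cancel : ∀ a → a + -1ℤ * a ≡ 0ℤ
  cancel = solve-∀
  difference-polynomial : Polynomial d (λ t → f t + -1ℤ * g t)
  difference-polynomial = Polynomial-+ d f _ p (Polynomial-scale d -1ℤ g q)
  difference : ∀ k → f (+ suc k) + -1ℤ * g (+ suc k) ≡ 0ℤ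
  difference k = trans (cong (λ x → f (+ suc k) + -1ℤ * x) (sym (f≡g (+ suc k) (λ ())))) (cancel (f (+ suc k)))
Polynomial-unique d p q f≡g t@(+ suc _)  = f≡g t (λ ())
Polynomial-unique d p q f≡g t@(-[1+ _ ]) = f≡g t (λ ())

-- The incidence structure of π

List-lookup-injective : ∀ {A : Set} {xs : List A} → Unique xs →
                        ∀ {i j} → List.lookup xs i ≡ List.lookup xs j → i ≡ j
List-lookup-injective (_  ∷ _) {zero}  {zero}  _  = refl
List-lookup-injective (x∉ ∷ _) {zero}  {suc j} eq = ⊥-elim (All.lookup x∉ (∈-lookup j) eq)
List-lookup-injective (x∉ ∷ _) {suc i} {zero}  eq = ⊥-elim (All.lookup x∉ (∈-lookup i) (sym eq))
List-lookup-injective (_  ∷ u) {suc i} {suc j} eq = cong suc (List-lookup-injective u eq)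

sum-indicator≡sum-image : ∀ {ℓ m} (ι : Fin ℓ → Fin m) → Injective _≡_ _≡_ ι → (p : Fin m → Bool) →
  (∀ D → p D ≡ true → ∃ λ i → ι i ≡ D) → (∀ i → p (ι i) ≡ true) →
  ∀ (f : Fin m → ℤ) → ∑[ D < m ] (b2z (p D) * f D) ≡ ∑[ i < ℓ ] f (ι i)
sum-indicator≡sum-image {ℓ} {m} ι ι-injective p p⇒image image⇒p f = begin
  ∑[ D < m ] (b2z (p D) * f D)                        ≡⟨ sum-cong-≗ indicator ⟩
  ∑[ D < m ] ∑[ i < ℓ ] scalar (f D) (ι i) D          ≡⟨ ∑-comm (λ D i → scalar (f D) (ι i) D) ⟩
  ∑[ i < ℓ ] ∑[ D < m ] scalar (f D) (ι i) D
    ≡⟨ sum-cong-≗ (λ i → sum-single _ (ι i) (λ D D≢ιi → scalar-offDiag (f D) (D≢ιi ∘ sym))) ⟩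
  ∑[ i < ℓ ] scalar (f (ι i)) (ι i) (ι i)             ≡⟨ sum-cong-≗ (λ i → scalar-diag (f (ι i)) (ι i)) ⟩
  ∑[ i < ℓ ] f (ι i)                                  ∎
  where
  open ≡-Reasoning
  indicator : ∀ D → b2z (p D) * f D ≡ ∑[ i < ℓ ] scalar (f D) (ι i) D
  indicator D with p D in pD
  ... | true with p⇒image D pD
  ...   | i₀ , refl = trans (*-identityˡ (f D)) (sym (trans
          (sum-single _ i₀ (λ i i≢i₀ → scalar-offDiag (f D) (i≢i₀ ∘ ι-injective)))
          (scalar-diag (f D) (ι i₀))))
  indicator D | false = sym (sum-zero (λ i → scalar-offDiag (f D) (outside-image i)))
    where
    outside-image : ∀ i → ι i ≢ D
    outside-image i ιi≡D with () ← trans (sym (image⇒p i)) (trans (cong p ιi≡D) pD)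

toGroup : ∀ {n} → FinGroup n → Group _ _
toGroup G = record { isGroup = FinGroup.isGroup G }

sum-b2z-lookup : ∀ {n} (p : Subset n) → ∑[ g < n ] b2z (lookup p g) ≡ + ∣ p ∣
sum-b2z-lookup []          = refl
sum-b2z-lookup (true ∷ p)  = cong (λ s → 1ℤ + s) (sum-b2z-lookup p)
sum-b2z-lookup (false ∷ p) = trans (+-identityˡ _) (sum-b2z-lookup p)

sum-b2z-⋃ : ∀ {n ℓ} (F : Fin ℓ → Subset n) x →
            (∀ i j → lookup (F i) x ≡ true → lookup (F j) x ≡ true → i ≡ j) →
            ∑[ i < ℓ ] b2z (lookup (F i) x) ≡ b2z (lookup (⋃ (List.tabulate F)) x)
sum-b2z-⋃ {ℓ = zero}  F x _ = sym (cong b2z (lookup-replicate x false))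
sum-b2z-⋃ {ℓ = suc ℓ} F x unique = begin
  b2z (lookup (F zero) x) + ∑[ i < ℓ ] b2z (lookup (F (suc i)) x) ≡⟨ split (lookup (F zero) x) refl ⟩
  b2z (lookup (F zero) x ∨ lookup (⋃ (List.tabulate (F ∘ suc))) x) ≡⟨ cong b2z (lookup-zipWith _∨_ x (F zero) _) ⟨
  b2z (lookup (⋃ (List.tabulate F)) x)                             ∎
  where
  open ≡-Reasoning
  split : ∀ b → lookup (F zero) x ≡ b →
          b2z b + ∑[ i < ℓ ] b2z (lookup (F (suc i)) x) ≡ b2z (b ∨ lookup (⋃ (List.tabulate (F ∘ suc))) x)
  split true  x∈F₀ = cong (λ s → 1ℤ + s) (sum-zero x∉Fₛ)
    where
    x∉Fₛ : ∀ i → b2z (lookup (F (suc i)) x) ≡ 0ℤ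
    x∉Fₛ i with lookup (F (suc i)) x in x∈Fₛ
    ... | true with () ← unique zero (suc i) x∈F₀ x∈Fₛ
    ... | false = refl
  split false _ = trans (+-identityˡ _) (sum-b2z-⋃ (F ∘ suc) x (λ i j p q → suc-injective (unique (suc i) (suc j) p q)))

module _ {n} (G : FinGroup n) where
  open FinGroup G
  open IsGroup isGroup using (assoc)
  open GroupProperties (toGroup G) using (⁻¹-anti-homo-∙; \\-leftDividesˡ; \\-leftDividesʳ)

  lookup-translate : ∀ g C h → lookup (translate G g C) h ≡ lookup C (inv g · h)
  lookup-translate g C = lookup∘tabulate _

  translate-∙ : ∀ a b C → translate G (a · b) C ≡ translate G a (translate G b C)
  translate-∙ a b C = tabulate-cong λ h → begin
    lookup C (inv (a · b) · h)          ≡⟨ cong (λ x → lookup C (x · h)) (⁻¹-anti-homo-∙ a b) ⟩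
    lookup C ((inv b · inv a) · h)      ≡⟨ cong (lookup C) (assoc (inv b) (inv a) h) ⟩
    lookup C (inv b · (inv a · h))      ≡⟨ lookup-translate b C (inv a · h) ⟨
    lookup (translate G b C) (inv a · h) ∎
    where open ≡-Reasoning

  translate-injective : ∀ g {C D} → translate G g C ≡ translate G g D → C ≡ D
  translate-injective g {C} {D} eq = trans (sym (tabulate∘lookup C)) (trans (tabulate-cong pointwise) (tabulate∘lookup D))
    where
    pointwise : ∀ h → lookup C h ≡ lookup D h
    pointwise h = begin
      lookup C h                            ≡⟨ cong (lookup C) (\\-leftDividesʳ g h) ⟨
      lookup C (inv g · (g · h))            ≡⟨ lookup-translate g C (g · h) ⟨
      lookup (translate G g C) (g · h)      ≡⟨ cong (λ X → lookup X (g · h)) eq ⟩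
      lookup (translate G g D) (g · h)      ≡⟨ lookup-translate g D (g · h) ⟩
      lookup D (inv g · (g · h))            ≡⟨ cong (lookup D) (\\-leftDividesʳ g h) ⟩
      lookup D h                            ∎
      where open ≡-Reasoning

  leftMultiplication : Fin n → Permutation n n
  leftMultiplication a = permutation (a ·_) (inv a ·_) (\\-leftDividesˡ a) (\\-leftDividesʳ a)

  translate-size : ∀ a C → ∑[ g < n ] b2z (lookup (translate G a C) g) ≡ + ∣ C ∣
  translate-size a C = begin
    ∑[ g < n ] b2z (lookup (translate G a C) g)   ≡⟨ sum-cong-≗ (λ g → cong b2z (lookup-translate a C g)) ⟩
    ∑[ g < n ] b2z (lookup C (inv a · g))         ≡⟨ sum-permute (λ g → b2z (lookup C g)) (leftMultiplication (inv a)) ⟨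
    ∑[ g < n ] b2z (lookup C g)                   ≡⟨ sum-b2z-lookup C ⟩
    + ∣ C ∣                                       ∎
    where open ≡-Reasoning

module _ {n k ℓ} (G : FinGroup n) {π : Fin ℓ → Subset n} (H : Hyp G k ℓ π) where
  open FinGroup G
  open IsGroup isGroup using (inverseˡ; identityʳ)
  open GroupProperties (toGroup G) using (⁻¹-anti-homo-∙; ⁻¹-involutive; \\-leftDividesˡ)
  open Hyp H
  open ListMembership using () renaming (_∈_ to _∈ₗ_)

  private
    β = blocks G π
    m = nβ G π
    translates : Fin n → List (Subset n)
    translates g = List.map (λ i → translate G g (π i)) (allFin ℓ)

  translate-∈-blocks : ∀ g i → translate G g (π i) ∈ₗ β
  translate-∈-blocks g i = ∈-deduplicate⁺ (≡-dec Boolₚ._≟_)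
    (∈-concatMap⁺ translates (Any.map (λ { refl → ∈-map⁺ (λ i → translate G g (π i)) (∈-allFin i) })
                                      (∈-allFin g)))

  ∈-blocks⁻ : ∀ {B} → B ∈ₗ β → ∃₂ λ g i → B ≡ translate G g (π i)
  ∈-blocks⁻ B∈β
    with g , B∈gπ ← Any.satisfied (∈-concatMap⁻ translates {xs = allFin n} (∈-deduplicate⁻ (≡-dec Boolₚ._≟_) _ B∈β))
    with i , _ , B≡gπᵢ ← ∈-map⁻ (λ i → translate G g (π i)) B∈gπ
    = g , i , B≡gπᵢ

  blocks-unique : Unique β
  blocks-unique = deduplicate-! (≡-dec Boolₚ._≟_) (concatMap translates (allFin n))

  cellOfBlock : Fin m → Fin ℓ
  cellOfBlock D = proj₁ (proj₂ (∈-blocks⁻ (∈-lookup D)))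

  blocks-through : ∀ h {B} → B ∈ₗ β → lookup B h ≡ true → ∃ λ j → B ≡ translate G h (π j)
  blocks-through h B∈β h∈B with ∈-blocks⁻ B∈β
  ... | g , i , refl
    with j , πⱼ ← T-axiom i (inv g · h) (lookup⇒[]= (inv g · h) (π i) (trans (sym (lookup-translate G g (π i) h)) h∈B)) =
    j , (begin
      translate G g (π i)                          ≡⟨ cong (λ x → translate G x (π i)) h∙s⁻¹≡g ⟨
      translate G (h · inv s) (π i)                ≡⟨ translate-∙ G h (inv s) (π i) ⟩
      translate G h (translate G (inv s) (π i))    ≡⟨ cong (translate G h) πⱼ ⟩
      translate G h (π j)                          ∎)
    where
    open ≡-Reasoning
    s = inv g · h
    h∙s⁻¹≡g : h · inv s ≡ g
    h∙s⁻¹≡g = begin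
      h · inv (inv g · h)         ≡⟨ cong (h ·_) (⁻¹-anti-homo-∙ (inv g) h) ⟩
      h · (inv h · inv (inv g))   ≡⟨ cong (λ x → h · (inv h · x)) (⁻¹-involutive g) ⟩
      h · (inv h · g)             ≡⟨ \\-leftDividesˡ h g ⟩
      g                           ∎

  blockIndex : Fin n → Fin ℓ → Fin m
  blockIndex h i = Any.index (translate-∈-blocks h i)

  lookup-blockIndex : ∀ h i → List.lookup β (blockIndex h i) ≡ translate G h (π i)
  lookup-blockIndex h i = sym (lookup-index (translate-∈-blocks h i))

  incidence : Fin n → Fin m → ℤ
  incidence g D = b2z (lookup (List.lookup β D) g)

  sum-incidence : ∀ h (f : Fin m → ℤ) → ∑[ D < m ] (incidence h D * f D) ≡ ∑[ i < ℓ ] f (blockIndex h i)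
  sum-incidence h = sum-indicator≡sum-image (blockIndex h) injective (λ D → lookup (List.lookup β D) h) cover hit
    where
    injective : ∀ {i j} → blockIndex h i ≡ blockIndex h j → i ≡ j
    injective {i} {j} eq = distinct (translate-injective G h
      (trans (sym (lookup-blockIndex h i)) (trans (cong (List.lookup β) eq) (lookup-blockIndex h j))))
    cover : ∀ D → lookup (List.lookup β D) h ≡ true → ∃ λ i → blockIndex h i ≡ D
    cover D h∈D with j , D≡hπⱼ ← blocks-through h (∈-lookup D) h∈D =
      j , List-lookup-injective blocks-unique (trans (lookup-blockIndex h j) (sym D≡hπⱼ))
    hit : ∀ i → lookup (List.lookup β (blockIndex h i)) h ≡ true
    hit i = begin
      lookup (List.lookup β (blockIndex h i)) h   ≡⟨ cong (λ B → lookup B h) (lookup-blockIndex h i) ⟩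
      lookup (translate G h (π i)) h              ≡⟨ lookup-translate G h (π i) h ⟩
      lookup (π i) (inv h · h)                    ≡⟨ cong (lookup (π i)) (inverseˡ h) ⟩
      lookup (π i) e                              ≡⟨ []=⇒lookup (contains-e i) ⟩
      true                                        ∎
      where open ≡-Reasoning

  lookup-Sπ : ∀ s → lookup (Sπ G π) s ≡ lookup (⋃ (List.tabulate π)) s ∧ not ⌊ s ≟ e ⌋
  lookup-Sπ s = trans (lookup∘tabulate _ s)
                      (cong (λ X → lookup (⋃ X) s ∧ not ⌊ s ≟ e ⌋) (map-tabulate (λ i → i) π))

  e∉Sπ : lookup (Sπ G π) e ≡ false
  e∉Sπ = trans (lookup-Sπ e) (∧-not-⌊e≟e⌋ _)
    where
    ∧-not-⌊e≟e⌋ : ∀ b → b ∧ not ⌊ e ≟ e ⌋ ≡ false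
    ∧-not-⌊e≟e⌋ b with e ≟ e
    ... | yes _  = ∧-zeroʳ b
    ... | no e≢e = ⊥-elim (e≢e refl)

  cells-through-e : ∑[ i < ℓ ] b2z (lookup (π i) e) ≡ + ℓ
  cells-through-e = begin
    ∑[ i < ℓ ] b2z (lookup (π i) e)   ≡⟨ sum-cong-≗ (λ i → cong b2z ([]=⇒lookup (contains-e i))) ⟩
    ∑[ i < ℓ ] (+ 1)                  ≡⟨ sum-const ℓ 1 ⟩
    + (ℓ ℕ.* 1)                       ≡⟨ cong +_ (ℕₚ.*-identityʳ ℓ) ⟩
    + ℓ                               ∎
    where open ≡-Reasoning

  cells-through-≢e : ∀ s → s ≢ e → ∑[ i < ℓ ] b2z (lookup (π i) s) ≡ b2z (lookup (Sπ G π) s)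
  cells-through-≢e s s≢e = begin
    ∑[ i < ℓ ] b2z (lookup (π i) s)              ≡⟨ sum-b2z-⋃ π s at-most-one ⟩
    b2z (lookup (⋃ (List.tabulate π)) s)         ≡⟨ cong b2z (∧-not-⌊s≟e⌋ _) ⟨
    b2z (lookup (⋃ (List.tabulate π)) s ∧ not ⌊ s ≟ e ⌋)  ≡⟨ cong b2z (lookup-Sπ s) ⟨
    b2z (lookup (Sπ G π) s)                      ∎
    where
    open ≡-Reasoning
    ∧-not-⌊s≟e⌋ : ∀ b → b ∧ not ⌊ s ≟ e ⌋ ≡ b
    ∧-not-⌊s≟e⌋ b with s ≟ e
    ... | yes s≡e = ⊥-elim (s≢e s≡e)
    ... | no _    = ∧-identityʳ b
    at-most-one : ∀ i j → lookup (π i) s ≡ true → lookup (π j) s ≡ true → i ≡ j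
    at-most-one i j s∈πᵢ s∈πⱼ with i ≟ j
    ... | yes i≡j = i≡j
    ... | no i≢j  = ⊥-elim (s≢e (x∈⁅y⁆⇒x≡y e (lookup⇒[]= s ⁅ e ⁆ (begin
      lookup ⁅ e ⁆ s                   ≡⟨ cong (λ X → lookup X s) (intersect i j i≢j) ⟨
      lookup (π i ∩ π j) s             ≡⟨ lookup-zipWith _∧_ s (π i) (π j) ⟩
      lookup (π i) s ∧ lookup (π j) s  ≡⟨ cong₂ _∧_ s∈πᵢ s∈πⱼ ⟩
      true                             ∎))))

  cells-through : ∀ g h → ∑[ i < ℓ ] b2z (lookup (π i) (inv h · g)) ≡ scalar (+ ℓ) g h + CayAdj G (Sπ G π) g h
  cells-through g h with g ≟ h
  ... | yes refl = begin
    ∑[ i < ℓ ] b2z (lookup (π i) (inv g · g))  ≡⟨ sum-cong-≗ (λ i → cong (b2z ∘ lookup (π i)) (inverseˡ g)) ⟩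
    ∑[ i < ℓ ] b2z (lookup (π i) e)            ≡⟨ cells-through-e ⟩
    + ℓ                                        ≡⟨ +-identityʳ (+ ℓ) ⟨
    + ℓ + b2z false                            ≡⟨ cong (λ b → + ℓ + b2z b) e∉Sπ ⟨
    + ℓ + b2z (lookup (Sπ G π) e)              ≡⟨ cong (λ x → + ℓ + b2z (lookup (Sπ G π) x)) (inverseˡ g) ⟨
    + ℓ + b2z (lookup (Sπ G π) (inv g · g))    ∎
    where open ≡-Reasoning
  ... | no g≢h = trans (cells-through-≢e (inv h · g) h⁻¹g≢e) (sym (+-identityˡ _))
    where
    h⁻¹g≢e : inv h · g ≢ e
    h⁻¹g≢e h⁻¹g≡e = g≢h (trans (sym (\\-leftDividesˡ h g)) (trans (cong (h ·_) h⁻¹g≡e) (identityʳ h)))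

  incidence-gram : ∀ g h → ∑[ D < m ] (incidence g D * incidence h D) ≡ scalar (+ ℓ) g h + CayAdj G (Sπ G π) g h
  incidence-gram g h = begin
    ∑[ D < m ] (incidence g D * incidence h D)   ≡⟨ sum-cong-≗ (λ D → *-comm (incidence g D) (incidence h D)) ⟩
    ∑[ D < m ] (incidence h D * incidence g D)   ≡⟨ sum-incidence h (incidence g) ⟩
    ∑[ i < ℓ ] incidence g (blockIndex h i)      ≡⟨ sum-cong-≗ (λ i → cong b2z (incidence-translate i)) ⟩
    ∑[ i < ℓ ] b2z (lookup (π i) (inv h · g))    ≡⟨ cells-through g h ⟩
    scalar (+ ℓ) g h + CayAdj G (Sπ G π) g h     ∎
    where
    open ≡-Reasoning
    incidence-translate : ∀ i → lookup (List.lookup β (blockIndex h i)) g ≡ lookup (π i) (inv h · g)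
    incidence-translate i = trans (cong (λ B → lookup B g) (lookup-blockIndex h i)) (lookup-translate G h (π i) g)

  block-size : ∀ D → ∑[ g < n ] incidence g D ≡ + k
  block-size D with a , i , D≡aπᵢ ← ∈-blocks⁻ (∈-lookup D) = begin
    ∑[ g < n ] incidence g D                        ≡⟨ sum-cong-≗ (λ g → cong (λ B → b2z (lookup B g)) D≡aπᵢ) ⟩
    ∑[ g < n ] b2z (lookup (translate G a (π i)) g) ≡⟨ translate-size G a (π i) ⟩
    + ∣ π i ∣                                       ≡⟨ cong +_ (size i) ⟩
    + k                                             ∎
    where open ≡-Reasoning

  point-degree : ∀ g → ∑[ D < m ] incidence g D ≡ + ℓ
  point-degree g = begin
    ∑[ D < m ] incidence g D          ≡⟨ sum-cong-≗ (λ D → *-identityʳ (incidence g D)) ⟨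
    ∑[ D < m ] (incidence g D * 1ℤ)   ≡⟨ sum-incidence g (λ _ → 1ℤ) ⟩
    ∑[ i < ℓ ] (+ 1)                  ≡⟨ sum-const ℓ 1 ⟩
    + (ℓ ℕ.* 1)                       ≡⟨ cong +_ (ℕₚ.*-identityʳ ℓ) ⟩
    + ℓ                               ∎
    where open ≡-Reasoning

  nβ*k≡n*ℓ : nβ G π ℕ.* k ≡ n ℕ.* ℓ
  nβ*k≡n*ℓ = +-injective (begin
    + (m ℕ.* k)                       ≡⟨ sum-const m k ⟨
    ∑[ D < m ] (+ k)                  ≡⟨ sum-cong-≗ block-size ⟨
    ∑[ D < m ] ∑[ g < n ] incidence g D ≡⟨ ∑-comm (λ D g → incidence g D) ⟩
    ∑[ g < n ] ∑[ D < m ] incidence g D ≡⟨ sum-cong-≗ point-degree ⟩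
    ∑[ g < n ] (+ ℓ)                  ≡⟨ sum-const n ℓ ⟩
    + (n ℕ.* ℓ)                       ∎)
    where open ≡-Reasoning

  cell-size≢0 : Fin ℓ → k ≢ 0
  cell-size≢0 i = subst (_≢ 0) (size i) (ℕₚ.m<n⇒n≢0 1≤∣πᵢ∣)
    where
    ⁅e⁆⊆πᵢ : ⁅ e ⁆ ⊆ π i
    ⁅e⁆⊆πᵢ x∈⁅e⁆ = subst (_∈ π i) (sym (x∈⁅y⁆⇒x≡y e x∈⁅e⁆)) (contains-e i)
    1≤∣πᵢ∣ : 1 ℕ.≤ ∣ π i ∣
    1≤∣πᵢ∣ = subst (ℕ._≤ ∣ π i ∣) (∣⁅x⁆∣≡1 e) (p⊆q⇒∣p∣≤∣q∣ ⁅e⁆⊆πᵢ)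

Fin→Fin0⇒≡0 : ∀ {a} → (Fin a → Fin 0) → a ≡ 0
Fin→Fin0⇒≡0 {zero}  _ = refl
Fin→Fin0⇒≡0 {suc a} f with () ← f zero

nβ-determined : ∀ {n k ℓ} {G G′ : FinGroup n} {π π′ : Fin ℓ → Subset n} →
                Hyp G k ℓ π → Hyp G′ k ℓ π′ → nβ G π ≡ nβ G′ π′
nβ-determined {ℓ = zero}  {G = G} {G′} H H′ =
  trans (Fin→Fin0⇒≡0 (cellOfBlock G H)) (sym (Fin→Fin0⇒≡0 (cellOfBlock G′ H′)))
nβ-determined {k = k} {ℓ = suc _} {G} {G′} H H′ =
  ℕₚ.*-cancelʳ-≡ _ _ k {{ℕ.≢-nonZero (cell-size≢0 G H zero)}} (trans (nβ*k≡n*ℓ G H) (sym (nβ*k≡n*ℓ G′ H′)))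

-- The characteristic polynomial of BCay(G, π)

scalar-splitAt : ∀ n {m} t (x y : Fin (n ℕ.+ m)) →
                 scalar t x y ≡ (if ⌊ Sum.≡-dec _≟_ _≟_ (splitAt n x) (splitAt n y) ⌋ then t else 0ℤ)
scalar-splitAt n {m} t x y with x ≟ y | Sum.≡-dec _≟_ _≟_ (splitAt n x) (splitAt n y)
... | yes _    | yes _  = refl
... | no _     | no _   = refl
... | yes refl | no x≢x = ⊥-elim (x≢x refl)
... | no x≢y   | yes eq = ⊥-elim (x≢y (trans (sym (join-splitAt n m x)) (trans (cong (join n m) eq) (join-splitAt n m y))))

module _ {n k ℓ} (G : FinGroup n) {π : Fin ℓ → Subset n} (H : Hyp G k ℓ π) where

  private
    m = nβ G π
    A = CayAdj G (Sπ G π)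
    -N = λ g D → - incidence G H g D
    -Nᵀ = λ D g → - incidence G H g D

  bipartite-charMatrix : ∀ t x y → scalar t x y - BCayAdj G π x y ≡ blockMatrix (scalar t) -N -Nᵀ (scalar t) x y
  bipartite-charMatrix t x y rewrite scalar-splitAt n t x y with splitAt n x | splitAt n y
  ... | inj₁ g | inj₁ h = trans (+-identityʳ _) (cong (λ b → if b then t else 0ℤ) (⌊⌋-map′ _ _ (g ≟ h)))
  ... | inj₁ g | inj₂ D = +-identityˡ _
  ... | inj₂ D | inj₁ g = +-identityˡ _
  ... | inj₂ D | inj₂ E = trans (+-identityʳ _) (cong (λ b → if b then t else 0ℤ) (⌊⌋-map′ _ _ (D ≟ E)))

  schurComplement-charMatrix : ∀ t g h → schurComplement t (scalar t) -N -Nᵀ g h ≡ scalar (t * t - + ℓ) g h - A g h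
  schurComplement-charMatrix t g h = begin
    t * scalar t g h - ∑[ D < m ] (-N g D * -Nᵀ D h)
      ≡⟨ cong (λ s → t * scalar t g h - s) (sum-cong-≗ (λ D → neg*neg (incidence G H g D) (incidence G H h D))) ⟩
    t * scalar t g h - ∑[ D < m ] (incidence G H g D * incidence G H h D)
      ≡⟨ cong (λ s → t * scalar t g h - s) (incidence-gram G H g h) ⟩
    t * scalar t g h - (scalar (+ ℓ) g h + A g h)   ≡⟨ diagonal ⟩
    scalar (t * t - + ℓ) g h - A g h                ∎
    where
    open ≡-Reasoning
    neg*neg : ∀ a b → - a * - b ≡ a * b
    neg*neg = solve-∀
    diagonal : t * scalar t g h - (scalar (+ ℓ) g h + A g h) ≡ scalar (t * t - + ℓ) g h - A g h
    diagonal with g ≟ h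
    ... | yes _ = regroup t (+ ℓ) (A g h)
      where regroup : ∀ t l a → t * t - (l + a) ≡ t * t - l - a
            regroup = solve-∀
    ... | no _  = regroup t (A g h)
      where regroup : ∀ t a → t * 0ℤ - (0ℤ + a) ≡ 0ℤ - a
            regroup = solve-∀

  charPoly-BCay : ∀ t → t ^ n * charPoly (n ℕ.+ m) (BCayAdj G π) t ≡ t ^ m * charPoly n A (t * t - + ℓ)
  charPoly-BCay t = begin
    t ^ n * charPoly (n ℕ.+ m) (BCayAdj G π) t
      ≡⟨ cong (t ^ n *_) (det-cong (n ℕ.+ m) (bipartite-charMatrix t)) ⟩
    t ^ n * det (n ℕ.+ m) (blockMatrix (scalar t) -N -Nᵀ (scalar t))
      ≡⟨ det-schur n m t (scalar t) -N -Nᵀ ⟩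
    t ^ m * det n (schurComplement t (scalar t) -N -Nᵀ)
      ≡⟨ cong (t ^ m *_) (det-cong n (schurComplement-charMatrix t)) ⟩
    t ^ m * charPoly n A (t * t - + ℓ)
      ∎
    where open ≡-Reasoning

proposition3p3 : (k ℓ n n′ : ℕ) (G : FinGroup n) (G′ : FinGroup n′)
    (π : Fin ℓ → Subset n) (π′ : Fin ℓ → Subset n′) →
    Hyp G k ℓ π → Hyp G′ k ℓ π′ →
    Cospectral n (CayAdj G (Sπ G π)) n′ (CayAdj G′ (Sπ G′ π′)) →
    Cospectral (n ℕ.+ nβ G π) (BCayAdj G π) (n′ ℕ.+ nβ G′ π′) (BCayAdj G′ π′)
proposition3p3 k ℓ n .n G G′ π π′ H H′ (refl , χA≡χA′) = cong (n ℕ.+_) m≡m′ , χ≡χ′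
  where
  open ≡-Reasoning
  m≡m′ = nβ-determined H H′
  χ = charPoly (n ℕ.+ nβ G π) (BCayAdj G π)
  χ′ = charPoly (n ℕ.+ nβ G′ π′) (BCayAdj G′ π′)
  χ≡χ′-off-0 : ∀ t → t ≢ 0ℤ → χ t ≡ χ′ t
  χ≡χ′-off-0 t t≢0 = *-cancelˡ-≡ (t ^ n) _ _ {{≢-nonZero (t≢0 ∘ i^n≡0⇒i≡0 t n)}} (begin
    t ^ n * χ t                                                     ≡⟨ charPoly-BCay G H t ⟩
    t ^ nβ G π * charPoly n (CayAdj G (Sπ G π)) (t * t - + ℓ)       ≡⟨ cong₂ (λ d x → t ^ d * x) m≡m′ (χA≡χA′ _) ⟩
    t ^ nβ G′ π′ * charPoly n (CayAdj G′ (Sπ G′ π′)) (t * t - + ℓ)  ≡⟨ charPoly-BCay G′ H′ t ⟨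
    t ^ n * χ′ t                                                    ∎)
  χ≡χ′ : ∀ t → χ t ≡ χ′ t
  χ≡χ′ = Polynomial-unique (n ℕ.+ nβ G π) (charPoly-polynomial _ (BCayAdj G π))
    (subst (λ d → Polynomial (n ℕ.+ d) χ′) (sym m≡m′) (charPoly-polynomial _ (BCayAdj G′ π′))) χ≡χ′-off-0
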